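{- For any two non-trivial finite simple connected graphs $G$ and $H$, $$\gamma_{P,c}(G\,\square\,H)\leq \min\{Z_c(G)\,\gamma_c(H),\ Z_c(H)\,\gamma_c(G)\}.$$
   Context: Power domination: for $S\subseteq V(G)$, start with $M(S)=N[S]$ and repeatedly add a vertex $w$ whenever some $v\in M(S)$ has $w$ as its unique neighbour outside $M(S)$; $S$ is a connected power dominating set if the final $M(S)$ is $V(G)$ and $\langle S\rangle$ is connected; $\gamma_{P,c}(G)$ is the minimum size of such a set. Zero forcing: colour the vertices of $Z\subseteq V(G)$ black and the rest white; repeatedly, if a black vertex has exactly one white neighbour, that neighbour becomes black. $Z$ is a zero forcing set if eventually all vertices are black; it is a connected zero forcing set if moreover $\langle Z\rangle$ is connected. $Z_c(G)$ is the minimum size of a connected zero forcing set. $\gamma_c(G)$ is the connected domination number. The Cartesian product $G\,\square\,H$ has vertex set $V(G)\times V(H)$, with $(a,b)\sim(x,y)$ iff either $a=x$ and $by\in E(H)$, or $b=y$ and $ax\in E(G)$. -}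

module Defs where

open import Data.Nat using (ℕ; _*_; _≤_)
open import Data.Fin using (Fin; _≟_; remQuot)
open import Data.Fin.Subset using (Subset; _∈_; ∣_∣)
open import Data.Bool using (Bool; true; false; _∧_; _∨_)
open import Data.Product using (_×_; _,_; proj₁; proj₂; ∃)
open import Data.Unit using (⊤)
open import Data.Sum using (_⊎_)
open import Relation.Nullary using (¬_)
open import Relation.Nullary.Decidable using (⌊_⌋)
open import Relation.Binary.PropositionalEquality using (_≡_; _≢_)

record Graph : Set where
  field
    n     : ℕ
    adj   : Fin n → Fin n → Bool
    adj-sym    : ∀ u v → adj u v ≡ adj v u
    adj-irrefl : ∀ u → adj u u ≡ false
open Graph public

Adj : (G : Graph) → Fin (n G) → Fin (n G) → Set
Adj G u v = adj G u v ≡ true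

NonTrivial : Graph → Set
NonTrivial G = 2 ≤ n G

data PathIn (G : Graph) (P : Fin (n G) → Set) : Fin (n G) → Fin (n G) → Set where
  here : ∀ {u} → P u → PathIn G P u u
  step : ∀ {u v w} → P u → Adj G u v → PathIn G P v w → PathIn G P u w

Connected : Graph → Set
Connected G = ∀ u v → PathIn G (λ _ → ⊤) u v

InducedConnected : (G : Graph) → Subset (n G) → Set
InducedConnected G S = ∀ u v → u ∈ S → v ∈ S → PathIn G (_∈ S) u v

InClosedNbhd : (G : Graph) → Subset (n G) → Fin (n G) → Set
InClosedNbhd G S v = v ∈ S ⊎ (∃ λ u → u ∈ S × Adj G u v)

IsConnectedDominatingSet : (G : Graph) → Subset (n G) → Set
IsConnectedDominatingSet G D =
  (∀ v → InClosedNbhd G D v) × InducedConnected G D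

-- Final monitored set M(S) of power domination, as the least set containing
-- N[S] closed under the propagation rule: if v is monitored and w is the only
-- neighbour of v that is (possibly) not monitored, w becomes monitored.
data Monitored (G : Graph) (S : Subset (n G)) : Fin (n G) → Set where
  dom  : ∀ {v} → InClosedNbhd G S v → Monitored G S v
  prop : ∀ {v w} → Monitored G S v → Adj G v w →
         (∀ x → Adj G v x → x ≢ w → Monitored G S x) → Monitored G S w

IsConnectedPowerDominatingSet : (G : Graph) → Subset (n G) → Set
IsConnectedPowerDominatingSet G S =
  (∀ v → Monitored G S v) × InducedConnected G S

data Black (G : Graph) (Z : Subset (n G)) : Fin (n G) → Set where
  init  : ∀ {v} → v ∈ Z → Black G Z v
  force : ∀ {v w} → Black G Z v → Adj G v w →
          (∀ x → Adj G v x → x ≢ w → Black G Z x) → Black G Z w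

IsConnectedZeroForcingSet : (G : Graph) → Subset (n G) → Set
IsConnectedZeroForcingSet G Z =
  (∀ v → Black G Z v) × InducedConnected G Z

-- Cartesian product G □ H on Fin (n G * n H); vertex (a , b) is
-- encoded as combine a b.
_□_ : Graph → Graph → Graph
G □ H = record
  { n = n G * n H
  ; adj = λ i j → pa (remQuot (n H) i) (remQuot (n H) j)
  ; adj-sym = λ i j → psym (remQuot (n H) i) (remQuot (n H) j)
  ; adj-irrefl = λ i → pirr (remQuot (n H) i)
  }
  where
  open import Relation.Binary.PropositionalEquality using (refl; cong₂; trans; sym)
  eqb : ∀ {k} → Fin k → Fin k → Bool
  eqb a x = ⌊ a ≟ x ⌋
  eqb-sym : ∀ {k} (a x : Fin k) → eqb a x ≡ eqb x a
  eqb-sym a x with a ≟ x | x ≟ a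
  ... | Relation.Nullary.yes _ | Relation.Nullary.yes _ = refl
  ... | Relation.Nullary.no _  | Relation.Nullary.no _  = refl
  ... | Relation.Nullary.yes p | Relation.Nullary.no q  = Data.Empty.⊥-elim (q (sym p))
    where import Data.Empty
  ... | Relation.Nullary.no p  | Relation.Nullary.yes q = Data.Empty.⊥-elim (p (sym q))
    where import Data.Empty
  eqb-refl : ∀ {k} (a : Fin k) → eqb a a ≡ true
  eqb-refl a with a ≟ a
  ... | Relation.Nullary.yes _ = refl
  ... | Relation.Nullary.no p = Data.Empty.⊥-elim (p refl)
    where import Data.Empty
  pa : Fin (n G) × Fin (n H) → Fin (n G) × Fin (n H) → Bool
  pa (a , b) (x , y) = (eqb a x ∧ adj H b y) ∨ (eqb b y ∧ adj G a x)
  psym : ∀ p q → pa p q ≡ pa q p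
  psym (a , b) (x , y) =
    cong₂ _∨_ (cong₂ _∧_ (eqb-sym a x) (adj-sym H b y))
              (cong₂ _∧_ (eqb-sym b y) (adj-sym G a x))
  pirr : ∀ p → pa p p ≡ false
  pirr (a , b) rewrite eqb-refl a | eqb-refl b | adj-irrefl H b | adj-irrefl G a = refl

{-# OPTIONS --safe #-}
module Submission where

-- Take S = Z × D.  Induced paths in ⟨Z⟩ and ⟨D⟩ combine into a row followed
-- by a column in ⟨Z × D⟩, so ⟨S⟩ is connected.  Every vertex (z , h) with
-- z ∈ Z is monitored because D dominates H.  A force v → w of the zero
-- forcing process in G is replayed in every H-fibre: the neighbours of
-- (v , h) are (v , y), monitored since v is, and (x , h) with x ≠ w, black
-- hence monitored; so (v , h) forces (w , h).

open import Defs
open import Data.Nat using (suc; _+_; _*_; _≤_)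
open import Data.Nat.Properties using (≤-reflexive; *-comm)
open import Data.Fin using (Fin; _≟_; combine; remQuot)
open import Data.Fin.Properties using (remQuot-combine; combine-remQuot)
open import Data.Fin.Subset using (Subset; _∈_; ∣_∣; inside; outside)
open import Data.Fin.Subset.Properties using (∣⊥∣≡0)
open import Data.Vec using ([]; _∷_; _++_; concat; map; lookup)
open import Data.Vec.Properties
  using ([]=⇒lookup; lookup⇒[]=; lookup-map; lookup-concat; map-id; map-const)
open import Data.Bool using (Bool; true; false; _∧_; _∨_)
open import Data.Bool.Properties using (T-≡; ∨-zeroʳ)
open import Data.Product using (_×_; _,_; proj₁; proj₂; ∃; swap)
open import Data.Sum using (_⊎_; inj₁; inj₂)
import Data.Sum as Sum
open import Function using (_∘_)
open import Function.Bundles using (_⇔_; mk⇔; Equivalence)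
open import Function.Properties.Equivalence using () renaming (trans to ⇔-trans)
open import Relation.Nullary.Decidable using (⌊_⌋; toWitness; isYes≗does; dec-true)
open import Relation.Binary.PropositionalEquality
open ≡-Reasoning

infixr 5 _++ₚ_

_++ₚ_ : ∀ {G : Graph} {Q : Fin (n G) → Set} {u v w} →
        PathIn G Q u v → PathIn G Q v w → PathIn G Q u w
here _       ++ₚ q = q
step u∈Q e p ++ₚ q = step u∈Q e (p ++ₚ q)

∧∨∧≡true : ∀ p q r s → (p ∧ q) ∨ (r ∧ s) ≡ true →
           (p ≡ true × q ≡ true) ⊎ (r ≡ true × s ≡ true)
∧∨∧≡true true  true  _     _     _  = inj₁ (refl , refl)
∧∨∧≡true true  false true  true  _  = inj₂ (refl , refl)
∧∨∧≡true true  false true  false ()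
∧∨∧≡true true  false false _     ()
∧∨∧≡true false _     true  true  _  = inj₂ (refl , refl)
∧∨∧≡true false _     true  false ()
∧∨∧≡true false _     false _     ()

∧≡true⇔ : ∀ {p q} → p ∧ q ≡ true ⇔ (p ≡ true × q ≡ true)
∧≡true⇔ {true}  = mk⇔ (refl ,_) (λ (_ , q≡true) → q≡true)
∧≡true⇔ {false} = mk⇔ (λ ()) (λ ())

≟-true : ∀ {k} {a x : Fin k} → ⌊ a ≟ x ⌋ ≡ true → a ≡ x
≟-true e = toWitness (Equivalence.from T-≡ e)

≟-refl : ∀ {k} (a : Fin k) → ⌊ a ≟ a ⌋ ≡ true
≟-refl a = trans (isYes≗does (a ≟ a)) (dec-true (a ≟ a) refl)

record IsCartesianProduct (A B P : Graph) : Set where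
  field
    pair         : Fin (n A) → Fin (n B) → Fin (n P)
    fst          : Fin (n P) → Fin (n A)
    snd          : Fin (n P) → Fin (n B)
    pair-fst-snd : ∀ i → pair (fst i) (snd i) ≡ i
    adj-pair⁻    : ∀ {a b x y} → Adj P (pair a b) (pair x y) →
                   (a ≡ x × Adj B b y) ⊎ (b ≡ y × Adj A a x)
    adj-pairʳ    : ∀ a {b y} → Adj B b y → Adj P (pair a b) (pair a y)
    adj-pairˡ    : ∀ {a x} b → Adj A a x → Adj P (pair a b) (pair x b)

  pair-elim : (Q : Fin (n P) → Set) → (∀ a b → Q (pair a b)) → ∀ i → Q i
  pair-elim Q f i = subst Q (pair-fst-snd i) (f (fst i) (snd i))

flip : ∀ {A B P} → IsCartesianProduct A B P → IsCartesianProduct B A P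
flip 𝒫 = record
  { pair         = λ b a → pair a b
  ; fst          = snd
  ; snd          = fst
  ; pair-fst-snd = pair-fst-snd
  ; adj-pair⁻    = Sum.swap ∘ adj-pair⁻
  ; adj-pairʳ    = λ b → adj-pairˡ b
  ; adj-pairˡ    = λ a → adj-pairʳ a
  }
  where open IsCartesianProduct 𝒫

module ProductPowerDomination
  {A B P : Graph} (𝒫 : IsCartesianProduct A B P)
  {Z : Subset (n A)} {D : Subset (n B)} {S : Subset (n P)}
  (pair∈S⇔ : ∀ a b → IsCartesianProduct.pair 𝒫 a b ∈ S ⇔ (a ∈ Z × b ∈ D))
  where

  open IsCartesianProduct 𝒫
  open Equivalence

  monitored-fibre : (∀ h → InClosedNbhd B D h) →
                    ∀ {a} → Black A Z a → ∀ b → Monitored P S (pair a b)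
  monitored-fibre dominating (init a∈Z) b with dominating b
  ... | inj₁ b∈D             = dom (inj₁ (from (pair∈S⇔ _ b) (a∈Z , b∈D)))
  ... | inj₂ (d , d∈D , d~b) =
    dom (inj₂ (pair _ d , from (pair∈S⇔ _ d) (a∈Z , d∈D) , adj-pairʳ _ d~b))
  monitored-fibre dominating (force {v} {w} v-black v~w others) b =
    prop (monitored-fibre dominating v-black b) (adj-pairˡ b v~w)
      (pair-elim (λ i → Adj P (pair v b) i → i ≢ pair w b → Monitored P S i)
                 neighbour)
    where
    neighbour : ∀ x y → Adj P (pair v b) (pair x y) → pair x y ≢ pair w b →
                Monitored P S (pair x y)
    neighbour x y vb~xy xy≢wb with adj-pair⁻ vb~xy
    ... | inj₁ (refl , _)   = monitored-fibre dominating v-black y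
    ... | inj₂ (refl , v~x) =
      monitored-fibre dominating (others x v~x λ { refl → xy≢wb refl }) b

  row-path : ∀ {a x} b → b ∈ D → PathIn A (_∈ Z) a x →
             PathIn P (_∈ S) (pair a b) (pair x b)
  row-path b b∈D (here a∈Z) = here (from (pair∈S⇔ _ b) (a∈Z , b∈D))
  row-path b b∈D (step a∈Z a~a′ p) =
    step (from (pair∈S⇔ _ b) (a∈Z , b∈D)) (adj-pairˡ b a~a′) (row-path b b∈D p)

  column-path : ∀ a {b y} → a ∈ Z → PathIn B (_∈ D) b y →
                PathIn P (_∈ S) (pair a b) (pair a y)
  column-path a a∈Z (here b∈D) = here (from (pair∈S⇔ a _) (a∈Z , b∈D))
  column-path a a∈Z (step b∈D b~b′ p) =
    step (from (pair∈S⇔ a _) (a∈Z , b∈D)) (adj-pairʳ a b~b′) (column-path a a∈Z p)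

  induced-connected : InducedConnected A Z → InducedConnected B D →
                      InducedConnected P S
  induced-connected Z-connected D-connected =
    pair-elim (λ u → ∀ v → u ∈ S → v ∈ S → PathIn P (_∈ S) u v) λ a b →
    pair-elim (λ v → pair a b ∈ S → v ∈ S → PathIn P (_∈ S) (pair a b) v) λ x y ab∈S xy∈S →
      let a∈Z , b∈D = to (pair∈S⇔ a b) ab∈S
          x∈Z , y∈D = to (pair∈S⇔ x y) xy∈S
      in row-path b b∈D (Z-connected a x a∈Z x∈Z)
         ++ₚ column-path x x∈Z (D-connected b y b∈D y∈D)

  isConnectedPowerDominatingSet :
    IsConnectedZeroForcingSet A Z → IsConnectedDominatingSet B D →
    IsConnectedPowerDominatingSet P S
  isConnectedPowerDominatingSet (all-black , Z-connected) (dominating , D-connected) =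
    pair-elim (Monitored P S) (λ a b → monitored-fibre dominating (all-black a) b)
    , induced-connected Z-connected D-connected

module _ (G H : Graph) where

  adj-□-combine : ∀ a b x y →
    adj (G □ H) (combine a b) (combine x y)
      ≡ (⌊ a ≟ x ⌋ ∧ adj H b y) ∨ (⌊ b ≟ y ⌋ ∧ adj G a x)
  adj-□-combine a b x y =
    cong₂ (λ (p q : Fin (n G) × Fin (n H)) → pa p q)
          (remQuot-combine a b) (remQuot-combine x y)
    where
    -- a copy of the private adjacency of G □ H in Defs, applied there to remQuot i and remQuot j
    pa : Fin (n G) × Fin (n H) → Fin (n G) × Fin (n H) → Bool
    pa (a , b) (x , y) = (⌊ a ≟ x ⌋ ∧ adj H b y) ∨ (⌊ b ≟ y ⌋ ∧ adj G a x)

  □-isCartesianProduct : IsCartesianProduct G H (G □ H)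
  □-isCartesianProduct = record
    { pair         = combine
    ; fst          = proj₁ ∘ remQuot {n G} (n H)
    ; snd          = proj₂ ∘ remQuot {n G} (n H)
    ; pair-fst-snd = combine-remQuot {n G} (n H)
    ; adj-pair⁻    = adj-pair⁻
    ; adj-pairʳ    = adj-pairʳ
    ; adj-pairˡ    = adj-pairˡ
    }
    where
    adj-pair⁻ : ∀ {a b x y} → Adj (G □ H) (combine a b) (combine x y) →
                (a ≡ x × Adj H b y) ⊎ (b ≡ y × Adj G a x)
    adj-pair⁻ {a} {b} {x} {y} e
      with ∧∨∧≡true _ _ _ _ (trans (sym (adj-□-combine a b x y)) e)
    ... | inj₁ (a≡x , b~y) = inj₁ (≟-true a≡x , b~y)
    ... | inj₂ (b≡y , a~x) = inj₂ (≟-true b≡y , a~x)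

    adj-pairʳ : ∀ a {b y} → Adj H b y → Adj (G □ H) (combine a b) (combine a y)
    adj-pairʳ a {b} {y} b~y = trans (adj-□-combine a b a y)
      (cong₂ (λ d e → (d ∧ e) ∨ (⌊ b ≟ y ⌋ ∧ adj G a a)) (≟-refl a) b~y)

    adj-pairˡ : ∀ {a x} b → Adj G a x → Adj (G □ H) (combine a b) (combine x b)
    adj-pairˡ {a} {x} b a~x = begin
      adj (G □ H) (combine a b) (combine x b)               ≡⟨ adj-□-combine a b x b ⟩
      (⌊ a ≟ x ⌋ ∧ adj H b b) ∨ (⌊ b ≟ b ⌋ ∧ adj G a x)   ≡⟨ cong ((⌊ a ≟ x ⌋ ∧ adj H b b) ∨_) (cong₂ _∧_ (≟-refl b) a~x) ⟩
      (⌊ a ≟ x ⌋ ∧ adj H b b) ∨ true                       ≡⟨ ∨-zeroʳ _ ⟩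
      true                                                  ∎

infixr 7 _⊗_

_⊗_ : ∀ {m k} → Subset m → Subset k → Subset (m * k)
X ⊗ Y = concat (map (λ x → map (x ∧_) Y) X)

∣++∣ : ∀ {m k} (X : Subset m) (Y : Subset k) → ∣ X ++ Y ∣ ≡ ∣ X ∣ + ∣ Y ∣
∣++∣ []            Y = refl
∣++∣ (inside  ∷ X) Y = cong suc (∣++∣ X Y)
∣++∣ (outside ∷ X) Y = ∣++∣ X Y

∣⊗∣ : ∀ {m k} (X : Subset m) (Y : Subset k) → ∣ X ⊗ Y ∣ ≡ ∣ X ∣ * ∣ Y ∣
∣⊗∣ [] Y = refl
∣⊗∣ (inside ∷ X) Y = begin
  ∣ map (true ∧_) Y ++ X ⊗ Y ∣       ≡⟨ ∣++∣ (map (true ∧_) Y) (X ⊗ Y) ⟩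
  ∣ map (true ∧_) Y ∣ + ∣ X ⊗ Y ∣    ≡⟨ cong₂ _+_ (cong ∣_∣ (map-id Y)) (∣⊗∣ X Y) ⟩
  ∣ Y ∣ + ∣ X ∣ * ∣ Y ∣               ∎
∣⊗∣ {k = k} (outside ∷ X) Y = begin
  ∣ map (false ∧_) Y ++ X ⊗ Y ∣      ≡⟨ ∣++∣ (map (false ∧_) Y) (X ⊗ Y) ⟩
  ∣ map (false ∧_) Y ∣ + ∣ X ⊗ Y ∣   ≡⟨ cong₂ _+_ (trans (cong ∣_∣ (map-const Y false)) (∣⊥∣≡0 k)) (∣⊗∣ X Y) ⟩
  ∣ X ∣ * ∣ Y ∣                       ∎

lookup-⊗ : ∀ {m k} (X : Subset m) (Y : Subset k) a b →
           lookup (X ⊗ Y) (combine a b) ≡ lookup X a ∧ lookup Y b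
lookup-⊗ X Y a b = begin
  lookup (X ⊗ Y) (combine a b)                    ≡⟨ lookup-concat (map (λ x → map (x ∧_) Y) X) a b ⟩
  lookup (lookup (map (λ x → map (x ∧_) Y) X) a) b ≡⟨ cong (λ Y′ → lookup Y′ b) (lookup-map a (λ x → map (x ∧_) Y) X) ⟩
  lookup (map (lookup X a ∧_) Y) b                ≡⟨ lookup-map b (lookup X a ∧_) Y ⟩
  lookup X a ∧ lookup Y b                         ∎

combine∈⊗⇔ : ∀ {m k} (X : Subset m) (Y : Subset k) a b →
             combine a b ∈ X ⊗ Y ⇔ (a ∈ X × b ∈ Y)
combine∈⊗⇔ X Y a b = mk⇔
  (λ ab∈X⊗Y →
    let a∈X , b∈Y = Equivalence.to ∧≡true⇔
                      (trans (sym (lookup-⊗ X Y a b)) ([]=⇒lookup ab∈X⊗Y))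
    in lookup⇒[]= a X a∈X , lookup⇒[]= b Y b∈Y)
  (λ (a∈X , b∈Y) → lookup⇒[]= (combine a b) (X ⊗ Y)
    (trans (lookup-⊗ X Y a b) (cong₂ _∧_ ([]=⇒lookup a∈X) ([]=⇒lookup b∈Y))))

theorem3 : (G H : Graph) → NonTrivial G → NonTrivial H → Connected G → Connected H →
    (∀ (Z : Subset (n G)) (D : Subset (n H)) →
      IsConnectedZeroForcingSet G Z → IsConnectedDominatingSet H D →
      ∃ λ (S : Subset (n (G □ H))) →
        IsConnectedPowerDominatingSet (G □ H) S × ∣ S ∣ ≤ ∣ Z ∣ * ∣ D ∣)
    × (∀ (Z : Subset (n H)) (D : Subset (n G)) →
      IsConnectedZeroForcingSet H Z → IsConnectedDominatingSet G D →
      ∃ λ (S : Subset (n (G □ H))) →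
        IsConnectedPowerDominatingSet (G □ H) S × ∣ S ∣ ≤ ∣ Z ∣ * ∣ D ∣)
theorem3 G H _ _ _ _ =
  (λ Z D Z-zf D-cd →
    Z ⊗ D ,
    isConnectedPowerDominatingSet (□-isCartesianProduct G H) (combine∈⊗⇔ Z D) Z-zf D-cd ,
    ≤-reflexive (∣⊗∣ Z D)) ,
  (λ Z D Z-zf D-cd →
    D ⊗ Z ,
    isConnectedPowerDominatingSet (flip (□-isCartesianProduct G H))
      (λ b a → ⇔-trans (combine∈⊗⇔ D Z a b) (mk⇔ swap swap)) Z-zf D-cd ,
    ≤-reflexive (trans (∣⊗∣ D Z) (*-comm ∣ D ∣ ∣ Z ∣)))
  where open ProductPowerDomination using (isConnectedPowerDominatingSet)
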